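{- Let $G=(V,E)$ be a finite graph and $n=|V|$. Then $\nu(G)=\frac{n-e(G)}{2}$. Moreover: (1) for any maximum matching $M$ of $G$, $G_M$ is a pec decomposition of $G$ with $e(G_M)=e(G)$; (2) for any pec decomposition $G'$ of $G$ with $e(G')=e(G)$, $\nu(G')=\nu(G)$.
   Context: $\nu(\cdot)$ denotes the maximum size of a matching. For $F\subseteq E$, $G_F=(V,F)$. A pec decomposition of $G$ is a spanning subgraph $G'=(V,E')$, $E'\subseteq E$, each of whose connected components is a path or a cycle of even length; path length = number of edges, and an isolated vertex counts as a path of length $0$ (an even path). $e(G')$ is the number of components of $G'$ that are even paths, and $e(G)=\min\{e(G') : G' \text{ a pec decomposition of } G\}$. -}

module Defs where

open import Data.Nat using (ℕ; zero; suc; _≤_; _*_; _+_)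
open import Data.Bool using (Bool; true; false)
open import Data.Fin using (Fin) renaming (_<_ to _<ᶠ_)
open import Data.Fin.Base using () renaming (_<_ to _<F_)
open import Data.List using (List; []; _∷_; _++_; [_]; length; concatMap; filter; allFin)
open import Data.List.Relation.Unary.All using (All)
open import Data.List.Relation.Unary.Any using (Any)
open import Data.List.Relation.Unary.Unique.Propositional using (Unique)
open import Data.List.Relation.Binary.Sublist.Propositional using (_⊆_)
open import Data.List.Relation.Binary.Permutation.Propositional using (_↭_)
open import Data.List.Membership.Propositional using (_∈_)
open import Data.Product using (Σ; _×_; _,_; proj₁; proj₂)
open import Data.Sum using (_⊎_)
open import Relation.Binary.PropositionalEquality using (_≡_)

-- An edge of a graph on vertex set Fin n is an ordered pair (i , j) with i < j,
-- representing the unordered edge {i, j}.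
Edge : ℕ → Set
Edge n = Fin n × Fin n

-- A finite simple graph on V = Fin n: a duplicate-free list of edges (i , j) with i < j.
-- An edge subset F ⊆ E is represented by a sublist of E (G_F = (V , F)).
IsSimpleGraph : {n : ℕ} → List (Edge n) → Set
IsSimpleGraph E = All (λ e → proj₁ e <F proj₂ e) E × Unique E

endpoints : {n : ℕ} → List (Edge n) → List (Fin n)
endpoints = concatMap (λ e → proj₁ e ∷ proj₂ e ∷ [])

IsMatching : {n : ℕ} → List (Edge n) → List (Edge n) → Set
IsMatching F M = (M ⊆ F) × Unique (endpoints M)

-- M is a maximum matching of G_F; then ν(G_F) = length M.
IsMaxMatching : {n : ℕ} → List (Edge n) → List (Edge n) → Set
IsMaxMatching F M = IsMatching F M × (∀ M' → IsMatching F M' → length M' ≤ length M)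

evenB : ℕ → Bool
evenB zero = true
evenB (suc zero) = false
evenB (suc (suc k)) = evenB k

consec : {A : Set} → List A → List (A × A)
consec [] = []
consec (x ∷ []) = []
consec (x ∷ y ∷ xs) = (x , y) ∷ consec (y ∷ xs)

-- A piece of a pec decomposition: either a path v ∷ vs (v_0 - v_1 - ... - v_k,
-- of length k = length vs; a single vertex is a path of length 0) or a cycle
-- v ∷ vs (v_0 - ... - v_{k} - v_0).
data Piece (n : ℕ) : Set where
  path  : Fin n → List (Fin n) → Piece n
  cycle : Fin n → List (Fin n) → Piece n

pieceVerts : {n : ℕ} → Piece n → List (Fin n)
pieceVerts (path v vs) = v ∷ vs
pieceVerts (cycle v vs) = v ∷ vs

pieceEdges : {n : ℕ} → Piece n → List (Fin n × Fin n)
pieceEdges (path v vs) = consec (v ∷ vs)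
pieceEdges (cycle v vs) = consec (v ∷ vs ++ [ v ])

ValidPiece : {n : ℕ} → Piece n → Set
ValidPiece (path v vs) = Data.Unit.⊤
  where import Data.Unit
ValidPiece (cycle v vs) = (3 ≤ length (v ∷ vs)) × (evenB (length (v ∷ vs)) ≡ true)

-- is the piece an even path (length = number of edges = length vs is even)?
isEvenPath : {n : ℕ} → Piece n → Bool
isEvenPath (path v vs) = evenB (length vs)
isEvenPath (cycle v vs) = false

-- D is a decomposition of G_F = (Fin n , F) into its connected components,
-- each of which is a path or an even cycle: the pieces are vertex-disjoint and
-- cover V (their vertex sequences together form a permutation of V), and the
-- edges of G_F are exactly the edges of the pieces.
IsPecOf : {n : ℕ} → List (Edge n) → List (Piece n) → Set
IsPecOf {n} F D =
  All ValidPiece D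
  × (concatMap pieceVerts D ↭ allFin n)
  × (∀ u v → ((u , v) ∈ F ⊎ (v , u) ∈ F)
           → Any (λ p → (u , v) ∈ pieceEdges p ⊎ (v , u) ∈ pieceEdges p) D)
  × (∀ u v → Any (λ p → (u , v) ∈ pieceEdges p ⊎ (v , u) ∈ pieceEdges p) D
           → ((u , v) ∈ F ⊎ (v , u) ∈ F))

evenCount : {n : ℕ} → List (Piece n) → ℕ
evenCount D = length (filter (λ p → Data.Bool._≟_ (isEvenPath p) true) D)
  where import Data.Bool

HasPecE : {n : ℕ} → List (Edge n) → ℕ → Set
HasPecE F k = Σ (List (Piece _)) (λ D → IsPecOf F D × evenCount D ≡ k)

-- k = e(G): minimum of e(G') over pec decompositions G' = G_F, F ⊆ E
IsEG : {n : ℕ} → List (Edge n) → ℕ → Set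
IsEG E k = Σ (List (Edge _)) (λ F → (F ⊆ E) × HasPecE F k)
         × (∀ F k' → F ⊆ E → HasPecE F k' → k ≤ k')

{-# OPTIONS --safe #-}

-- Taking every other edge along each piece of a pec decomposition of a subgraph gives a matching
-- that misses exactly one vertex of each even path, so n ≤ 2ν(G) + e(G') for every pec
-- decomposition G'.  Conversely a matching M is itself a pec decomposition G_M whose even paths
-- are its uncovered vertices, so 2|M| + e(G_M) = n; for a maximum matching this gives
-- 2ν(G) + e(G) ≤ n.  Hence 2ν(G) + e(G) = n, e(G_M) = e(G), and (2) follows by applying the
-- first bound inside an optimal G'.
module Submission where

open import Defs
open import Data.Bool using (Bool; true; false; not; if_then_else_)
open import Data.Bool.Properties using (not-involutive)
open import Data.Empty using (⊥; ⊥-elim)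
open import Data.Fin using (Fin) renaming (_<_ to _<F_)
import Data.Fin.Properties as Fin
open import Data.List using (List; []; _∷_; _++_; [_]; length; map; filter; allFin; concatMap)
open import Data.List.Properties
  using (length-++; length-filter; filter-++; concatMap-++; concatMap-map; concatMap-pure; length-tabulate)
open import Data.List.Membership.Propositional using (_∈_; _∉_)
open import Data.List.Membership.Propositional.Properties using (∈-filter⁺; ∈-filter⁻; ∈-++⁺ˡ; ∈-++⁺ʳ; ∈-++⁻; ∈-allFin)
open import Data.List.Membership.Propositional.Properties.WithK using (unique∧set⇒bag)
import Data.List.Membership.DecPropositional as DecMembership
open import Data.List.Relation.Binary.BagAndSetEquality using (∼bag⇒↭)
open import Data.List.Relation.Binary.Permutation.Propositional using (_↭_; ↭-sym; ↭⇒↭ₛ)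
open import Data.List.Relation.Binary.Permutation.Propositional.Properties using (↭-length)
import Data.List.Relation.Binary.Permutation.Setoid.Properties as PermutationSetoid
open import Data.List.Relation.Binary.Sublist.Propositional using (_⊆_; []; _∷_; _∷ʳ_; ⊆-refl; ⊆-trans; minimum; lookup)
open import Data.List.Relation.Binary.Sublist.Propositional.Properties using (All-resp-⊆; filter-⊆) renaming (++⁺ to ⊆-++⁺)
open import Data.List.Relation.Unary.All using (All; []; _∷_)
open import Data.List.Relation.Unary.All.Properties using (All¬⇒¬Any; ¬Any⇒All¬)
import Data.List.Relation.Unary.All as All
import Data.List.Relation.Unary.All.Properties as All
open import Data.List.Relation.Unary.AllPairs using ([]; _∷_)
open import Data.List.Relation.Unary.Any using (Any; here; there; satisfied)
import Data.List.Relation.Unary.Any as Any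
import Data.List.Relation.Unary.Any.Properties as Any
open import Data.List.Relation.Unary.Unique.Propositional using (Unique)
import Data.List.Relation.Unary.Unique.Propositional.Properties as Unique
open import Data.Nat using (ℕ; zero; suc; _+_; _*_; _≤_)
open import Data.Nat.Properties
  using (≤-trans; ≤-antisym; ≤-reflexive; +-monoˡ-≤; +-monoʳ-≤; *-monoʳ-≤; *-cancelˡ-≤; +-cancelˡ-≡; +-cancelʳ-≤; *-suc)
open import Data.Nat.Tactic.RingSolver using (solve-∀)
open import Data.Product using (Σ; _×_; _,_; proj₁; proj₂; swap)
open import Data.Product.Properties using (≡-dec)
open import Data.Sum using (_⊎_; inj₁; inj₂)
import Data.Sum as Sum
open import Function using (_∘_; mk⇔)
open import Relation.Binary.Definitions using (DecidableEquality)
open import Relation.Binary.PropositionalEquality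
  using (_≡_; _≢_; refl; sym; trans; cong; cong₂; subst; subst₂; setoid; module ≡-Reasoning)
open import Relation.Nullary using (Dec; yes; no; ¬?)
open import Relation.Nullary.Decidable using (_⊎-dec_)

private variable
  A : Set
  n : ℕ

Unique-resp-↭ : {xs ys : List A} → xs ↭ ys → Unique xs → Unique ys
Unique-resp-↭ {A = A} p = PermutationSetoid.Unique-resp-↭ (setoid A) (↭⇒↭ₛ p)

Unique-resp-⊇ : {xs ys : List A} → xs ⊆ ys → Unique ys → Unique xs
Unique-resp-⊇ []         u       = u
Unique-resp-⊇ (y ∷ʳ p)   (_ ∷ u) = Unique-resp-⊇ p u
Unique-resp-⊇ (refl ∷ p) (a ∷ u) = All-resp-⊆ p a ∷ Unique-resp-⊇ p u

unique-set⇒↭ : {xs ys : List A} → Unique xs → Unique ys →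
               (∀ {x} → x ∈ xs → x ∈ ys) → (∀ {x} → x ∈ ys → x ∈ xs) → xs ↭ ys
unique-set⇒↭ uxs uys to from = ∼bag⇒↭ (unique∧set⇒bag uxs uys (mk⇔ to from))

unique-length-mono : DecidableEquality A → {xs ys : List A} → Unique xs → Unique ys →
                     (∀ {x} → x ∈ xs → x ∈ ys) → length xs ≤ length ys
unique-length-mono _≟_ {xs} {ys} uxs uys sub =
  ≤-trans (≤-reflexive (↭-length xs↭filter)) (length-filter (_∈? xs) ys)
  where
  open DecMembership _≟_ using (_∈?_)
  xs↭filter : xs ↭ filter (_∈? xs) ys
  xs↭filter = unique-set⇒↭ uxs (Unique.filter⁺ (_∈? xs) uys)
    (λ x∈xs → ∈-filter⁺ (_∈? xs) (sub x∈xs) x∈xs) (λ x∈filter → proj₂ (∈-filter⁻ (_∈? xs) {xs = ys} x∈filter))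

ends : Edge n → List (Fin n)
ends e = proj₁ e ∷ proj₂ e ∷ []

Loopless : Edge n → Set
Loopless e = proj₁ e ≢ proj₂ e

Ordered : Edge n → Set
Ordered e = proj₁ e <F proj₂ e

VertexDisjoint : List (Edge n) → Set
VertexDisjoint L = ∀ {e e' x} → e ∈ L → e' ∈ L → x ∈ ends e → x ∈ ends e' → e ≡ e'

IsSimpleGraph-⊆ : {E F : List (Edge n)} → F ⊆ E → IsSimpleGraph E → IsSimpleGraph F
IsSimpleGraph-⊆ F⊆E (ordered , unique) = All-resp-⊆ F⊆E ordered , Unique-resp-⊇ F⊆E unique

length-endpoints : (L : List (Edge n)) → length (endpoints L) ≡ 2 * length L
length-endpoints []      = refl
length-endpoints (e ∷ L) = trans (cong (suc ∘ suc) (length-endpoints L)) (sym (*-suc 2 (length L)))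

∈-endpoints⁺ : {L : List (Edge n)} {e : Edge n} {x : Fin n} → e ∈ L → x ∈ ends e → x ∈ endpoints L
∈-endpoints⁺ (here refl)        x∈e = ∈-++⁺ˡ x∈e
∈-endpoints⁺ {L = e ∷ _} (there e'∈L) x∈e' = ∈-++⁺ʳ (ends e) (∈-endpoints⁺ e'∈L x∈e')

∈-endpoints⁻ : (L : List (Edge n)) {x : Fin n} → x ∈ endpoints L → Σ (Edge n) λ e → e ∈ L × x ∈ ends e
∈-endpoints⁻ (e ∷ L) x∈ with ∈-++⁻ (ends e) x∈
... | inj₁ x∈e = e , here refl , x∈e
... | inj₂ x∈L with ∈-endpoints⁻ L x∈L
...   | e' , e'∈L , x∈e' = e' , there e'∈L , x∈e'

Unique-endpoints⇒VertexDisjoint : {L : List (Edge n)} → Unique (endpoints L) → VertexDisjoint L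
Unique-endpoints⇒VertexDisjoint u (here refl) (here refl) _ _ = refl
Unique-endpoints⇒VertexDisjoint {L = _ ∷ L} u (here refl) (there e'∈L) x∈e x∈e' =
  ⊥-elim (ends-fresh {L = L} u x∈e (∈-endpoints⁺ e'∈L x∈e'))
  where
  ends-fresh : ∀ {e : Edge n} {L x} → Unique (endpoints (e ∷ L)) → x ∈ ends e → x ∉ endpoints L
  ends-fresh ((_ ∷ fresh₁) ∷ fresh₂ ∷ _) (here refl)         = All¬⇒¬Any fresh₁
  ends-fresh (_ ∷ fresh₂ ∷ _)            (there (here refl)) = All¬⇒¬Any fresh₂
Unique-endpoints⇒VertexDisjoint u (there e∈L) (here refl) x∈e x∈e' =
  sym (Unique-endpoints⇒VertexDisjoint u (here refl) (there e∈L) x∈e' x∈e)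
Unique-endpoints⇒VertexDisjoint (_ ∷ _ ∷ u) (there e∈L) (there e'∈L) x∈e x∈e' =
  Unique-endpoints⇒VertexDisjoint u e∈L e'∈L x∈e x∈e'

VertexDisjoint⇒Unique-endpoints : {L : List (Edge n)} →
                                  All Loopless L → Unique L → VertexDisjoint L → Unique (endpoints L)
VertexDisjoint⇒Unique-endpoints []                  []            _        = []
VertexDisjoint⇒Unique-endpoints {L = e ∷ L} (loopless ∷ looplessL) (fresh ∷ u) disjoint =
  (loopless ∷ ¬Any⇒All¬ _ (away (here refl))) ∷ ¬Any⇒All¬ _ (away (there (here refl)))
    ∷ VertexDisjoint⇒Unique-endpoints looplessL u (λ p q → disjoint (there p) (there q))
  where
  away : ∀ {x} → x ∈ ends e → x ∉ endpoints L
  away x∈e x∈L with ∈-endpoints⁻ L x∈L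
  ... | e' , e'∈L , x∈e' = All.lookup fresh e'∈L (disjoint (here refl) (there e'∈L) x∈e x∈e')

ends-swap : (e : Edge n) {x : Fin n} → x ∈ ends (swap e) → x ∈ ends e
ends-swap e (here x≡)         = there (here x≡)
ends-swap e (there (here x≡)) = here x≡

Ordered-orientation-unique : {e e' s : Edge n} → Ordered e → Ordered e' →
                      e ≡ s ⊎ swap e ≡ s → e' ≡ s ⊎ swap e' ≡ s → e ≡ e'
Ordered-orientation-unique _  _  (inj₁ refl) (inj₁ refl) = refl
Ordered-orientation-unique e< e'< (inj₁ refl) (inj₂ refl) = ⊥-elim (Fin.<-asym e< e'<)
Ordered-orientation-unique e< e'< (inj₂ refl) (inj₁ refl) = ⊥-elim (Fin.<-asym e< e'<)
Ordered-orientation-unique _  _  (inj₂ refl) (inj₂ refl) = refl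

-- Pieces may traverse an edge of F against its orientation i < j; filtering F repairs this.
orientation-matching : {F S : List (Edge n)} → IsSimpleGraph F → Unique (endpoints S) →
                       (∀ {s} → s ∈ S → s ∈ F ⊎ swap s ∈ F) →
                       Σ (List (Edge n)) λ M → IsMatching F M × length S ≤ length M
orientation-matching {n = n} {F} {S} (ordered , uniqueF) uniqueS S⊆F =
  M , (filter-⊆ orients? F , uniqueM) , *-cancelˡ-≤ 2 endpoints-length
  where
  open DecMembership (≡-dec Fin._≟_ Fin._≟_) using (_∈?_)

  Orients : Edge n → Set
  Orients e = e ∈ S ⊎ swap e ∈ S

  orients? : (e : Edge n) → Dec (Orients e)
  orients? e = (e ∈? S) ⊎-dec (swap e ∈? S)

  M : List (Edge n)
  M = filter orients? F

  ordered-M : ∀ {e} → e ∈ M → Ordered e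
  ordered-M e∈M = All.lookup ordered (proj₁ (∈-filter⁻ orients? e∈M))

  oriented-edge : ∀ {e x} → e ∈ M → x ∈ ends e → Σ (Edge n) λ s → s ∈ S × x ∈ ends s × (e ≡ s ⊎ swap e ≡ s)
  oriented-edge {e} e∈M x∈e with proj₂ (∈-filter⁻ orients? {xs = F} e∈M)
  ... | inj₁ e∈S      = e , e∈S , x∈e , inj₁ refl
  ... | inj₂ swap-e∈S = swap e , swap-e∈S , ends-swap (swap e) x∈e , inj₂ refl

  disjoint : VertexDisjoint M
  disjoint e∈M e'∈M x∈e x∈e' with oriented-edge e∈M x∈e | oriented-edge e'∈M x∈e'
  ... | s , s∈S , x∈s , e~s | s' , s'∈S , x∈s' , e'~s'
    rewrite Unique-endpoints⇒VertexDisjoint uniqueS s∈S s'∈S x∈s x∈s' =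
    Ordered-orientation-unique (ordered-M e∈M) (ordered-M e'∈M) e~s e'~s'

  uniqueM : Unique (endpoints M)
  uniqueM = VertexDisjoint⇒Unique-endpoints
    (All.tabulate (Fin.<⇒≢ ∘ ordered-M)) (Unique.filter⁺ orients? uniqueF) disjoint

  covered : ∀ {x} → x ∈ endpoints S → x ∈ endpoints M
  covered x∈S with ∈-endpoints⁻ S x∈S
  ... | s , s∈S , x∈s with S⊆F s∈S
  ...   | inj₁ s∈F      = ∈-endpoints⁺ (∈-filter⁺ orients? s∈F (inj₁ s∈S)) x∈s
  ...   | inj₂ swap-s∈F = ∈-endpoints⁺ (∈-filter⁺ orients? swap-s∈F (inj₂ s∈S)) (ends-swap (swap s) x∈s)

  endpoints-length : 2 * length S ≤ 2 * length M
  endpoints-length = subst₂ _≤_ (length-endpoints S) (length-endpoints M)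
    (unique-length-mono Fin._≟_ uniqueS uniqueM covered)

pairUp : List A → List (A × A)
pairUp []           = []
pairUp (x ∷ [])     = []
pairUp (x ∷ y ∷ xs) = (x , y) ∷ pairUp xs

endpoints-pairUp-⊆ : (xs : List (Fin n)) → endpoints (pairUp xs) ⊆ xs
endpoints-pairUp-⊆ []           = []
endpoints-pairUp-⊆ (x ∷ [])     = x ∷ʳ []
endpoints-pairUp-⊆ (x ∷ y ∷ xs) = refl ∷ refl ∷ endpoints-pairUp-⊆ xs

consec-⊆-∷ : (y : A) (xs : List A) → consec xs ⊆ consec (y ∷ xs)
consec-⊆-∷ y []       = []
consec-⊆-∷ y (x ∷ xs) = (y , x) ∷ʳ ⊆-refl

consec-⊆-++ : (xs ys : List A) → consec xs ⊆ consec (xs ++ ys)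
consec-⊆-++ []           ys = minimum _
consec-⊆-++ (x ∷ [])     ys = minimum _
consec-⊆-++ (x ∷ y ∷ xs) ys = refl ∷ consec-⊆-++ (y ∷ xs) ys

pairUp-⊆-consec : (xs : List A) → pairUp xs ⊆ consec xs
pairUp-⊆-consec []           = []
pairUp-⊆-consec (x ∷ [])     = []
pairUp-⊆-consec (x ∷ y ∷ xs) = refl ∷ ⊆-trans (pairUp-⊆-consec xs) (consec-⊆-∷ y xs)

pairUp-⊆-pieceEdges : (p : Piece n) → pairUp (pieceVerts p) ⊆ pieceEdges p
pairUp-⊆-pieceEdges (path v vs)  = pairUp-⊆-consec (v ∷ vs)
pairUp-⊆-pieceEdges (cycle v vs) = ⊆-trans (pairUp-⊆-consec (v ∷ vs)) (consec-⊆-++ (v ∷ vs) [ v ])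

-- Every other edge of each piece; it misses exactly one vertex of each even path and no other vertex.
pieceMatching : List (Piece n) → List (Edge n)
pieceMatching = concatMap (pairUp ∘ pieceVerts)

pieceMatching-edge : (D : List (Piece n)) {s : Edge n} → s ∈ pieceMatching D → Any (λ p → s ∈ pieceEdges p) D
pieceMatching-edge (p ∷ D) s∈ with ∈-++⁻ (pairUp (pieceVerts p)) s∈
... | inj₁ s∈p = here (lookup (pairUp-⊆-pieceEdges p) s∈p)
... | inj₂ s∈D = there (pieceMatching-edge D s∈D)

endpoints-pieceMatching-⊆ : (D : List (Piece n)) → endpoints (pieceMatching D) ⊆ concatMap pieceVerts D
endpoints-pieceMatching-⊆ []      = []
endpoints-pieceMatching-⊆ (p ∷ D) =
  subst (_⊆ concatMap pieceVerts (p ∷ D)) (sym (concatMap-++ ends (pairUp (pieceVerts p)) (pieceMatching D)))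
    (⊆-++⁺ (endpoints-pairUp-⊆ (pieceVerts p)) (endpoints-pieceMatching-⊆ D))

indicator : Bool → ℕ
indicator b = if b then 1 else 0

evenB-suc : ∀ m → evenB (suc m) ≡ not (evenB m)
evenB-suc zero          = refl
evenB-suc (suc zero)    = refl
evenB-suc (suc (suc m)) = evenB-suc m

length-pairUp : (xs : List A) → 2 * length (pairUp xs) + indicator (not (evenB (length xs))) ≡ length xs
length-pairUp []           = refl
length-pairUp (x ∷ [])     = refl
length-pairUp (x ∷ y ∷ xs) =
  trans (cong (_+ indicator (not (evenB (length xs)))) (*-suc 2 (length (pairUp xs))))
        (cong (suc ∘ suc) (length-pairUp xs))

length-pairUp-piece : (p : Piece n) → ValidPiece p →
                      2 * length (pairUp (pieceVerts p)) + indicator (isEvenPath p) ≡ length (pieceVerts p)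
length-pairUp-piece (path v vs) _ =
  trans (cong (λ b → 2 * length (pairUp (v ∷ vs)) + indicator b) (sym odd-order))
        (length-pairUp (v ∷ vs))
  where
  odd-order : not (evenB (suc (length vs))) ≡ evenB (length vs)
  odd-order = trans (cong not (evenB-suc (length vs))) (not-involutive _)
length-pairUp-piece (cycle v vs) (_ , even-order) =
  trans (cong (λ b → 2 * length (pairUp (v ∷ vs)) + indicator (not b)) (sym even-order))
        (length-pairUp (v ∷ vs))

evenCount-∷ : (p : Piece n) (D : List (Piece n)) → evenCount (p ∷ D) ≡ indicator (isEvenPath p) + evenCount D
evenCount-∷ p D with isEvenPath p
... | true  = refl
... | false = refl

length-pieceMatching : {D : List (Piece n)} → All ValidPiece D →
                       2 * length (pieceMatching D) + evenCount D ≡ length (concatMap pieceVerts D)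
length-pieceMatching {D = []} [] = refl
length-pieceMatching {n = n} {D = p ∷ D} (valid ∷ validD) = begin
  2 * length (P ++ pieceMatching D) + evenCount (p ∷ D)
    ≡⟨ cong₂ (λ a b → 2 * a + b) (length-++ P) (evenCount-∷ p D) ⟩
  2 * (length P + length (pieceMatching D)) + (indicator (isEvenPath p) + evenCount D)
    ≡⟨ interchange (length P) (length (pieceMatching D)) (indicator (isEvenPath p)) (evenCount D) ⟩
  (2 * length P + indicator (isEvenPath p)) + (2 * length (pieceMatching D) + evenCount D)
    ≡⟨ cong₂ _+_ (length-pairUp-piece p valid) (length-pieceMatching validD) ⟩
  length (pieceVerts p) + length (concatMap pieceVerts D)
    ≡⟨ length-++ (pieceVerts p) ⟨
  length (concatMap pieceVerts (p ∷ D)) ∎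
  where
  open ≡-Reasoning
  P : List (Edge n)
  P = pairUp (pieceVerts p)
  interchange : ∀ a b i c → 2 * (a + b) + (i + c) ≡ (2 * a + i) + (2 * b + c)
  interchange = solve-∀

pieceMatching-count : {F : List (Edge n)} {D : List (Piece n)} → IsPecOf F D →
                      2 * length (pieceMatching D) + evenCount D ≡ n
pieceMatching-count {n = n} {D = D} (valid , cover , _) = begin
  2 * length (pieceMatching D) + evenCount D  ≡⟨ length-pieceMatching valid ⟩
  length (concatMap pieceVerts D)             ≡⟨ ↭-length cover ⟩
  length (allFin n)                           ≡⟨ length-tabulate (λ i → i) ⟩
  n                                           ∎
  where open ≡-Reasoning

pec⇒matching : {F : List (Edge n)} {D : List (Piece n)} → IsSimpleGraph F → IsPecOf F D →
               Σ (List (Edge n)) λ M → IsMatching F M × n ≤ 2 * length M + evenCount D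
pec⇒matching {n = n} {F} {D} simple pec@(_ , cover , _ , piece-edges-in-F) =
  let M , matching , |S|≤|M| = orientation-matching simple uniqueS S⊆F
  in  M , matching , subst (_≤ 2 * length M + evenCount D) (pieceMatching-count pec)
                       (+-monoˡ-≤ (evenCount D) (*-monoʳ-≤ 2 |S|≤|M|))
  where
  S : List (Edge n)
  S = pieceMatching D
  uniqueS : Unique (endpoints S)
  uniqueS = Unique-resp-⊇ (endpoints-pieceMatching-⊆ D) (Unique-resp-↭ (↭-sym cover) (Unique.allFin⁺ n))
  S⊆F : ∀ {s} → s ∈ S → s ∈ F ⊎ swap s ∈ F
  S⊆F s∈S = piece-edges-in-F _ _ (Any.map inj₁ (pieceMatching-edge D s∈S))

edgePiece : Edge n → Piece n
edgePiece e = path (proj₁ e) [ proj₂ e ]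

vertexPiece : Fin n → Piece n
vertexPiece v = path v []

uncovered : List (Edge n) → List (Fin n)
uncovered {n} M = filter (λ v → ¬? (v ∈? endpoints M)) (allFin n)
  where open DecMembership Fin._≟_ using (_∈?_)

-- A matching M decomposes G_M into its edges (odd paths) and its uncovered vertices (even paths).
matchingPieces : List (Edge n) → List (Piece n)
matchingPieces M = map edgePiece M ++ map vertexPiece (uncovered M)

evenCount-++ : (D D' : List (Piece n)) → evenCount (D ++ D') ≡ evenCount D + evenCount D'
evenCount-++ D D' = trans (cong length (filter-++ _ D D')) (length-++ (filter _ D))

evenCount-edgePieces : (M : List (Edge n)) → evenCount (map edgePiece M) ≡ 0
evenCount-edgePieces []      = refl
evenCount-edgePieces (_ ∷ M) = evenCount-edgePieces M

evenCount-vertexPieces : (U : List (Fin n)) → evenCount (map vertexPiece U) ≡ length U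
evenCount-vertexPieces []      = refl
evenCount-vertexPieces (_ ∷ U) = cong suc (evenCount-vertexPieces U)

evenCount-matchingPieces : (M : List (Edge n)) → evenCount (matchingPieces M) ≡ length (uncovered M)
evenCount-matchingPieces M = begin
  evenCount (matchingPieces M)
    ≡⟨ evenCount-++ (map edgePiece M) _ ⟩
  evenCount (map edgePiece M) + evenCount (map vertexPiece (uncovered M))
    ≡⟨ cong₂ _+_ (evenCount-edgePieces M) (evenCount-vertexPieces (uncovered M)) ⟩
  length (uncovered M) ∎
  where open ≡-Reasoning

vertices-matchingPieces : (M : List (Edge n)) → concatMap pieceVerts (matchingPieces M) ≡ endpoints M ++ uncovered M
vertices-matchingPieces M = begin
  concatMap pieceVerts (map edgePiece M ++ map vertexPiece (uncovered M))
    ≡⟨ concatMap-++ pieceVerts (map edgePiece M) _ ⟩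
  concatMap pieceVerts (map edgePiece M) ++ concatMap pieceVerts (map vertexPiece (uncovered M))
    ≡⟨ cong₂ _++_ (concatMap-map pieceVerts edgePiece M)
                  (trans (concatMap-map pieceVerts vertexPiece (uncovered M)) (concatMap-pure (uncovered M))) ⟩
  endpoints M ++ uncovered M ∎
  where open ≡-Reasoning

covered-or-uncovered : (M : List (Edge n)) → Unique (endpoints M) → endpoints M ++ uncovered M ↭ allFin n
covered-or-uncovered {n} M uniqueM =
  unique-set⇒↭ (Unique.++⁺ uniqueM (Unique.filter⁺ notCovered? (Unique.allFin⁺ n)) disjoint)
               (Unique.allFin⁺ n) (λ {v} _ → ∈-allFin v) covered-or-not
  where
  open DecMembership Fin._≟_ using (_∈?_)
  notCovered? : (v : Fin n) → Dec (v ∉ endpoints M)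
  notCovered? v = ¬? (v ∈? endpoints M)
  disjoint : ∀ {v} → v ∈ endpoints M × v ∈ uncovered M → ⊥
  disjoint (covered , v∈U) = proj₂ (∈-filter⁻ notCovered? {xs = allFin n} v∈U) covered
  covered-or-not : ∀ {v} → v ∈ allFin n → v ∈ endpoints M ++ uncovered M
  covered-or-not {v} v∈V with v ∈? endpoints M
  ... | yes covered = ∈-++⁺ˡ covered
  ... | no  v∉M     = ∈-++⁺ʳ (endpoints M) (∈-filter⁺ notCovered? v∈V v∉M)

matchingPieces-edges⁺ : (M : List (Edge n)) {u v : Fin n} → (u , v) ∈ M ⊎ (v , u) ∈ M →
                        Any (λ p → (u , v) ∈ pieceEdges p ⊎ (v , u) ∈ pieceEdges p) (matchingPieces M)
matchingPieces-edges⁺ M uv∈M = Any.++⁺ˡ (Any.map⁺ (Any.map (Sum.map here here) (Any.Any-⊎⁺ uv∈M)))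

matchingPieces-edges⁻ : (M : List (Edge n)) {u v : Fin n} →
                        Any (λ p → (u , v) ∈ pieceEdges p ⊎ (v , u) ∈ pieceEdges p) (matchingPieces M) →
                        (u , v) ∈ M ⊎ (v , u) ∈ M
matchingPieces-edges⁻ M uv∈pieces with Any.++⁻ (map edgePiece M) uv∈pieces
... | inj₁ in-edge   = Any.Any-⊎⁻ (Any.map (Sum.map Any.singleton⁻ Any.singleton⁻) (Any.map⁻ in-edge))
... | inj₂ in-vertex = ⊥-elim (Sum.[ Any.¬Any[] , Any.¬Any[] ] (proj₂ (satisfied (Any.map⁻ in-vertex))))

matching⇒pec : (M : List (Edge n)) → Unique (endpoints M) → Σ ℕ λ c → HasPecE M c × 2 * length M + c ≡ n
matching⇒pec {n} M uniqueM =
  length (uncovered M) ,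
  (matchingPieces M , (valid , vertices , (λ _ _ → matchingPieces-edges⁺ M) , (λ _ _ → matchingPieces-edges⁻ M)) ,
   evenCount-matchingPieces M) ,
  count
  where
  valid : All ValidPiece (matchingPieces M)
  valid = All.++⁺ (All.map⁺ (All.universal _ M)) (All.map⁺ (All.universal _ (uncovered M)))
  vertices : concatMap pieceVerts (matchingPieces M) ↭ allFin n
  vertices = subst (_↭ allFin n) (sym (vertices-matchingPieces M)) (covered-or-uncovered M uniqueM)
  count : 2 * length M + length (uncovered M) ≡ n
  count = begin
    2 * length M + length (uncovered M)            ≡⟨ cong (_+ length (uncovered M)) (length-endpoints M) ⟨
    length (endpoints M) + length (uncovered M)    ≡⟨ length-++ (endpoints M) ⟨
    length (endpoints M ++ uncovered M)            ≡⟨ ↭-length (covered-or-uncovered M uniqueM) ⟩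
    length (allFin n)                              ≡⟨ length-tabulate (λ i → i) ⟩
    n                                              ∎
    where open ≡-Reasoning

n≤2ν+e : {E F M : List (Edge n)} {c : ℕ} → IsSimpleGraph E → F ⊆ E → HasPecE F c → IsMaxMatching E M →
         n ≤ 2 * length M + c
n≤2ν+e simple F⊆E (_ , pec , refl) (_ , maximum)
  with pec⇒matching (IsSimpleGraph-⊆ F⊆E simple) pec
... | M' , (M'⊆F , uniqueM') , bound =
  ≤-trans bound (+-monoˡ-≤ _ (*-monoʳ-≤ 2 (maximum M' (⊆-trans M'⊆F F⊆E , uniqueM'))))

mainTheorem5 : (n : ℕ) (E : List (Edge n)) → IsSimpleGraph E →
      (∀ M k → IsMaxMatching E M → IsEG E k → 2 * length M + k ≡ n)
    × (∀ M k → IsMaxMatching E M → IsEG E k → HasPecE M k)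
    × (∀ F k M M' → F ⊆ E → IsEG E k → HasPecE F k →
         IsMaxMatching E M → IsMaxMatching F M' → length M' ≡ length M)
mainTheorem5 n E simple = 2ν+e≡n , maximum-matching-pec , optimal-pec-preserves-ν
  where
  2ν+e≡n : ∀ M k → IsMaxMatching E M → IsEG E k → 2 * length M + k ≡ n
  2ν+e≡n M k maxM ((F , F⊆E , pecF) , minimal) =
    let c , pecM , count = matching⇒pec M (proj₂ (proj₁ maxM))
    in  ≤-antisym (subst (2 * length M + k ≤_) count (+-monoʳ-≤ _ (minimal M c (proj₁ (proj₁ maxM)) pecM)))
                  (n≤2ν+e simple F⊆E pecF maxM)

  maximum-matching-pec : ∀ M k → IsMaxMatching E M → IsEG E k → HasPecE M k
  maximum-matching-pec M k maxM eg =
    let c , pecM , count = matching⇒pec M (proj₂ (proj₁ maxM))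
    in  subst (HasPecE M) (+-cancelˡ-≡ (2 * length M) c k (trans count (sym (2ν+e≡n M k maxM eg)))) pecM

  optimal-pec-preserves-ν : ∀ F k M M' → F ⊆ E → IsEG E k → HasPecE F k →
                            IsMaxMatching E M → IsMaxMatching F M' → length M' ≡ length M
  optimal-pec-preserves-ν F k M M' F⊆E eg pecF maxM maxM'@((M'⊆F , uniqueM') , _) =
    ≤-antisym (proj₂ maxM M' (⊆-trans M'⊆F F⊆E , uniqueM'))
              (*-cancelˡ-≤ 2 (+-cancelʳ-≤ k _ _
                (subst (_≤ 2 * length M' + k) (sym (2ν+e≡n M k maxM eg))
                       (n≤2ν+e (IsSimpleGraph-⊆ F⊆E simple) ⊆-refl pecF maxM'))))
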